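{- Let $\sigma$ be a finite signature whose constant symbols are interpreted in a $\sigma$-structure $\mathfrak A$ by a tuple $\bar{\mathfrak u}$ and in a $\sigma$-structure $\mathfrak B$ by a tuple $\bar{\mathfrak v}$. Let $\mathfrak{A},\mathfrak{B}$ be finite, let $\bar a\in |\mathfrak{A}|^t$ and $\bar b\in|\mathfrak{B}|^t$ be such that $\bar{\mathfrak u}$ and $\bar a$ share no element and $\bar{\mathfrak v}$ and $\bar b$ share no element, and let $S$ be a finite $\Gamma$-labelled forest. Then the following are equivalent: (i) $[\mathfrak{A},\bar a]\leadsto_{S} [\mathfrak{B},\bar b]$; (ii) $tp^{S}_t (\mathfrak{A},\bar a)\subseteq tp^{S}_t (\mathfrak{B},\bar b)$.
   Context: $\Gamma=\{\exists,\forall\}$; a $\Gamma$-labelled forest is a finite disjoint union of rooted directed trees (arcs from father to child) with nodes labelled $\exists$ or $\forall$. For tuples $\bar c\in|\mathfrak A|^n$, $\bar d\in|\mathfrak B|^n$, the pair $(\bar c,\bar d)$ defines a partial isomorphism if, for every relation symbol $R$ of $\sigma$ and equality, and every choice of indices, $(c_{i_1},\dots,c_{i_k})\in R^{\mathfrak A}$ iff $(d_{i_1},\dots,d_{i_k})\in R^{\mathfrak B}$, and for every constant $c$ and index $i$, $c_i=c^{\mathfrak A}$ iff $d_i=c^{\mathfrak B}$. $[\mathfrak A,\bar a]$ is the expansion of $\mathfrak A$ by a new tuple of constant symbols interpreted by $\bar a$ (similarly $[\mathfrak B,\bar b]$, same new symbols). The game $G_S(\mathfrak A',\mathfrak B')$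 on structures $\mathfrak A',\mathfrak B'$ of the same signature whose constants are interpreted by $\bar u'$, $\bar v'$: the spoiler first chooses a tree $\mathcal T$ of $S$ and puts a token on its root. In each round, if the token is on a node labelled $\exists$ the spoiler picks an element of $\mathfrak A'$ and the duplicator answers with an element of $\mathfrak B'$; if it is labelled $\forall$ the spoiler picks in $\mathfrak B'$ and the duplicator answers in $\mathfrak A'$; then, unless the token is on a leaf, the spoiler moves the token to a child of the current node. If after some round the picked sequences $\bar c$ in $\mathfrak A'$ and $\bar d$ in $\mathfrak B'$ are such that $(\bar u'\bar c,\bar v'\bar d)$ does not define a partial isomorphism (in particular, also before any round, with $\bar c,\bar d$ empty), the spoiler wins; the game ends when the spoiler wins or after the round played at a leaf, and the duplicator wins if the spoiler has not won. $\mathfrak A'\leadsto_S\mathfrak B'$ means the duplicator has a winning strategy in $G_S(\mathfrak A',\mathfrak B')$. Formulas are in negation normal form; the quantifier structure $qs(\varphi)$ is the $\Gamma$-labelled forest given by: literal $\mapsto$ empty; conjunction/disjunction $\mapsto$ disjoint union; $\exists x\,\theta$ (resp. $\forall x\,\theta$) $\mapsto$ a new $\exists$ (resp. $\forall$) node with an arc to each root of $qs(\theta)$. $S'\preceq_e S$ means there is a label-preserving, not necessarily injective map $\iota$ from nodes of $S'$ to nodes of $S$ with each arc $x\to y$ of $S'$ giving a directed path of length $\ge1$ from $\iota(x)$ to $\iota(y)$ in $S$. $tp^S_t(\mathfrak A,\bar a)$ is the set of first-order $\sigma$-formulas $\varphi(x_1,\dots,x_t)$ with $qs(\varphi)\preceq_e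 S$ such that $\mathfrak A\models\varphi(\bar a)$. -}

module Defs where

open import Data.Nat using (ℕ; suc; _+_)
open import Data.Fin using (Fin)
open import Data.Vec using (Vec; []; _∷_; _∷ʳ_; _++_; lookup; map; tabulate)
open import Data.List using (List; []; _∷_) renaming (_++_ to _++ₗ_)
open import Data.Bool using (Bool; true)
open import Data.Product using (Σ; _×_)
open import Data.Unit using (⊤)
open import Relation.Binary.PropositionalEquality using (_≡_)
open import Relation.Unary using (Pred)
open import Function.Bundles using (_⇔_)
open import Relation.Nullary using (¬_)
open import Data.Sum using (_⊎_)

record Signature : Set where
  field
    nR : ℕ
    ar : Fin nR → ℕ
    nC : ℕ
open Signature public

-- Finite (nonempty) σ-structures: universe Fin (suc size); relations are
-- (decidable, as the structure is finite) Boolean-valued predicates on tuples.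
record Structure (σ : Signature) : Set where
  field
    size  : ℕ
    rel   : (R : Fin (nR σ)) → Vec (Fin (suc size)) (ar σ R) → Bool
    const : Fin (nC σ) → Fin (suc size)
open Structure public

Car : ∀ {σ} → Structure σ → Set
Car A = Fin (suc (size A))

consts : ∀ {σ} (A : Structure σ) → Vec (Car A) (nC σ)
consts A = tabulate (const A)

expandSig : Signature → ℕ → Signature
expandSig σ t = record { nR = nR σ ; ar = ar σ ; nC = nC σ + t }

expand : ∀ {σ t} (A : Structure σ) → Vec (Car A) t → Structure (expandSig σ t)
expand A a = record
  { size = size A
  ; rel = rel A
  ; const = λ j → lookup (consts A ++ a) j
  }

data Γ : Set where
  ∃ₗ ∀ₗ : Γ

data Tree : Set where
  node : Γ → List Tree → Tree

Forest : Set
Forest = List Tree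

data TPos : Tree → Set
data FPos : Forest → Set

data TPos where
  here  : ∀ {g ts} → TPos (node g ts)
  below : ∀ {g ts} → FPos ts → TPos (node g ts)

data FPos where
  hd : ∀ {t ts} → TPos t → FPos (t ∷ ts)
  tl : ∀ {t ts} → FPos ts → FPos (t ∷ ts)

tlabel : ∀ {t} → TPos t → Γ
flabel : ∀ {S} → FPos S → Γ
tlabel {node g ts} here = g
tlabel (below p) = flabel p
flabel (hd p) = tlabel p
flabel (tl p) = flabel p

data FRoot : ∀ {S} → FPos S → Set where
  hd : ∀ {g us ts} → FRoot {node g us ∷ ts} (hd here)
  tl : ∀ {t ts} {p : FPos ts} → FRoot p → FRoot {t ∷ ts} (tl p)

data TChild : ∀ {t} → TPos t → TPos t → Set
data FChild : ∀ {S} → FPos S → FPos S → Set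

data TChild where
  root  : ∀ {g ts} {r : FPos ts} → FRoot r → TChild {node g ts} here (below r)
  below : ∀ {g ts} {p q : FPos ts} → FChild p q → TChild {node g ts} (below p) (below q)

data FChild where
  hd : ∀ {t ts} {p q : TPos t} → TChild p q → FChild {t ∷ ts} (hd p) (hd q)
  tl : ∀ {t ts} {p q : FPos ts} → FChild p q → FChild {t ∷ ts} (tl p) (tl q)

data TPath : ∀ {t} → TPos t → TPos t → Set
data FPath : ∀ {S} → FPos S → FPos S → Set

data TPath where
  root  : ∀ {g ts} {q : FPos ts} → TPath {node g ts} here (below q)
  below : ∀ {g ts} {p q : FPos ts} → FPath p q → TPath {node g ts} (below p) (below q)

data FPath where
  hd : ∀ {t ts} {p q : TPos t} → TPath p q → FPath {t ∷ ts} (hd p) (hd q)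
  tl : ∀ {t ts} {p q : FPos ts} → FPath p q → FPath {t ∷ ts} (tl p) (tl q)

_⪯ₑ_ : Forest → Forest → Set
S′ ⪯ₑ S = Σ (FPos S′ → FPos S) λ ι →
  ((x : FPos S′) → flabel (ι x) ≡ flabel x) ×
  ((x y : FPos S′) → FChild x y → FPath (ι x) (ι y))

-- First-order formulas in negation normal form, with n free variables
-- (variables Fin n; quantifiers bind variable zero, de Bruijn style).

data Term (σ : Signature) (n : ℕ) : Set where
  var : Fin n → Term σ n
  con : Fin (nC σ) → Term σ n

data Formula (σ : Signature) : ℕ → Set where
  atom  : ∀ {n} (R : Fin (nR σ)) → Vec (Term σ n) (ar σ R) → Formula σ n
  natom : ∀ {n} (R : Fin (nR σ)) → Vec (Term σ n) (ar σ R) → Formula σ n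
  eq    : ∀ {n} → Term σ n → Term σ n → Formula σ n
  neq   : ∀ {n} → Term σ n → Term σ n → Formula σ n
  _∧_   : ∀ {n} → Formula σ n → Formula σ n → Formula σ n
  _∨_   : ∀ {n} → Formula σ n → Formula σ n → Formula σ n
  ex    : ∀ {n} → Formula σ (suc n) → Formula σ n
  all   : ∀ {n} → Formula σ (suc n) → Formula σ n

qs : ∀ {σ n} → Formula σ n → Forest
qs (atom R ts) = []
qs (natom R ts) = []
qs (eq s t) = []
qs (neq s t) = []
qs (φ ∧ ψ) = qs φ ++ₗ qs ψ
qs (φ ∨ ψ) = qs φ ++ₗ qs ψ
qs (ex φ) = node ∃ₗ (qs φ) ∷ []
qs (all φ) = node ∀ₗ (qs φ) ∷ []

evalT : ∀ {σ n} (A : Structure σ) → Vec (Car A) n → Term σ n → Car A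
evalT A ρ (var i) = lookup ρ i
evalT A ρ (con c) = const A c

Sat : ∀ {σ n} (A : Structure σ) → Vec (Car A) n → Formula σ n → Set
Sat A ρ (atom R ts) = rel A R (map (evalT A ρ) ts) ≡ true
Sat A ρ (natom R ts) = ¬ (rel A R (map (evalT A ρ) ts) ≡ true)
Sat A ρ (eq s t) = evalT A ρ s ≡ evalT A ρ t
Sat A ρ (neq s t) = ¬ (evalT A ρ s ≡ evalT A ρ t)
Sat A ρ (φ ∧ ψ) = Sat A ρ φ × Sat A ρ ψ
Sat A ρ (φ ∨ ψ) = Sat A ρ φ ⊎ Sat A ρ ψ
Sat A ρ (ex φ) = Σ (Car A) λ a → Sat A (a ∷ ρ) φ
Sat A ρ (all φ) = (a : Car A) → Sat A (a ∷ ρ) φ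

tp : ∀ {σ t} → Forest → (A : Structure σ) → Vec (Car A) t → Pred (Formula σ t) _
tp S A a φ = (qs φ ⪯ₑ S) × Sat A a φ

module _ {σ : Signature} (A B : Structure σ) where

  PartialIso : ∀ {m} → Vec (Car A) m → Vec (Car B) m → Set
  PartialIso {m} e f =
    ((R : Fin (nR σ)) (is : Vec (Fin m) (ar σ R)) →
        (rel A R (map (lookup e) is) ≡ true) ⇔ (rel B R (map (lookup f) is) ≡ true)) ×
    ((i j : Fin m) → (lookup e i ≡ lookup e j) ⇔ (lookup f i ≡ lookup f j)) ×
    ((c : Fin (nC σ)) (i : Fin m) → (lookup e i ≡ const A c) ⇔ (lookup f i ≡ const B c))

  -- Duplicator wins the remaining game when the token is on the root of the
  -- given tree (resp. whichever tree of the forest spoiler chooses), the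
  -- sequences picked so far being c̄, d̄.
  WinT : ∀ {m} → Tree → Vec (Car A) m → Vec (Car B) m → Set
  WinF : ∀ {m} → Forest → Vec (Car A) m → Vec (Car B) m → Set
  WinT (node ∃ₗ ts) c d = (x : Car A) → Σ (Car B) λ y →
    PartialIso (consts A ++ (c ∷ʳ x)) (consts B ++ (d ∷ʳ y)) × WinF ts (c ∷ʳ x) (d ∷ʳ y)
  WinT (node ∀ₗ ts) c d = (y : Car B) → Σ (Car A) λ x →
    PartialIso (consts A ++ (c ∷ʳ x)) (consts B ++ (d ∷ʳ y)) × WinF ts (c ∷ʳ x) (d ∷ʳ y)
  WinF [] c d = ⊤
  WinF (t ∷ ts) c d = WinT t c d × WinF ts c d

  Duplicates : Forest → Set
  Duplicates S = PartialIso (consts A ++ []) (consts B ++ []) × WinF S [] []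

-- Both directions rest on the same picture of G_S: a formula whose quantifier
-- structure embeds into S is a strategy description for the game.
--
-- (i) ⇒ (ii): evaluate φ in A and B side by side.  At a quantifier, the node ι(p)
-- of S it is mapped to is a position where duplicator still wins; spoiler plays
-- the witness of φ there and duplicator's answer is the witness on the other
-- side.  Literals transfer because the chosen elements form a partial
-- isomorphism.  As arcs of qs φ only map to paths of S, the nodes in between are
-- played through with arbitrary moves.
--
-- (ii) ⇒ (i): since A is finite, each tree T of S has a Hintikka formula,
-- conjoining over every spoiler move x in A ("∃y. the diagram of x, y holds and
-- so do the formulas of the children") at ∃-nodes and disjoining over every
-- answer x in A at ∀-nodes.  It holds in A, has quantifier structure embedding
-- into T, so by (ii) it holds in B, where it reads as a winning strategy.
module Submission where

open import Defs
open import Data.Nat using (ℕ; zero; suc; _+_)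
open import Data.Fin using (Fin; zero; suc; _↑ˡ_; _↑ʳ_; inject₁; fromℕ)
open import Data.Fin.Properties using (_≟_)
open import Data.Vec using (Vec; []; _∷_; _∷ʳ_; _++_; lookup; map; tabulate)
open import Data.Vec.Properties
  using (lookup-++ˡ; lookup-++ʳ; lookup-map; lookup∘tabulate; tabulate∘lookup; tabulate-∘;
         map-++; map-∷ʳ; map-∘; map-cong)
open import Data.List using ([]; _∷_) renaming (_++_ to _++ₗ_)
open import Data.Bool using (Bool; true; false)
open import Data.Bool.Properties using (not-¬)
open import Data.Product using (Σ; _×_; _,_; proj₁; proj₂)
open import Data.Sum using (inj₁; inj₂)
open import Data.Unit using (⊤; tt)
open import Relation.Binary.PropositionalEquality
open import Relation.Unary using (_⊆_)
open import Relation.Nullary using (yes; no; contradiction)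
open import Relation.Nullary.Decidable using (⌊_⌋)
open import Function.Bundles using (_⇔_; mk⇔; Equivalence)
open import Function using (_∘_; id)

open Equivalence using (to; from)

module _ {X : Set} where

  lookup-∷ʳ-inject₁ : ∀ {m} (c : Vec X m) x k → lookup (c ∷ʳ x) (inject₁ k) ≡ lookup c k
  lookup-∷ʳ-inject₁ (y ∷ c) x zero    = refl
  lookup-∷ʳ-inject₁ (y ∷ c) x (suc k) = lookup-∷ʳ-inject₁ c x k

  lookup-∷ʳ-fromℕ : ∀ {m} (c : Vec X m) x → lookup (c ∷ʳ x) (fromℕ m) ≡ x
  lookup-∷ʳ-fromℕ []      x = refl
  lookup-∷ʳ-fromℕ (y ∷ c) x = lookup-∷ʳ-fromℕ c x

inject∷ʳ : ∀ K {m} → Fin (K + m) → Fin (K + suc m)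
inject∷ʳ zero    k       = inject₁ k
inject∷ʳ (suc K) zero    = zero
inject∷ʳ (suc K) (suc k) = suc (inject∷ʳ K k)

last∷ʳ : ∀ K m → Fin (K + suc m)
last∷ʳ K m = K ↑ʳ fromℕ m

module _ {X : Set} where

  lookup-inject∷ʳ : ∀ {K m} (v : Vec X K) (c : Vec X m) x k →
    lookup (v ++ (c ∷ʳ x)) (inject∷ʳ K k) ≡ lookup (v ++ c) k
  lookup-inject∷ʳ []      c x k       = lookup-∷ʳ-inject₁ c x k
  lookup-inject∷ʳ (w ∷ v) c x zero    = refl
  lookup-inject∷ʳ (w ∷ v) c x (suc k) = lookup-inject∷ʳ v c x k

  lookup-last∷ʳ : ∀ {K m} (v : Vec X K) (c : Vec X m) x → lookup (v ++ (c ∷ʳ x)) (last∷ʳ K m) ≡ x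
  lookup-last∷ʳ v c x = trans (lookup-++ʳ v (c ∷ʳ x) _) (lookup-∷ʳ-fromℕ c x)

label : Tree → Γ
label (node g _) = g

children : Tree → Forest
children (node _ ts) = ts

subtreeT : ∀ {T} → TPos T → Tree
subtreeF : ∀ {F} → FPos F → Tree
subtreeT {T} here  = T
subtreeT (below p) = subtreeF p
subtreeF (hd p) = subtreeT p
subtreeF (tl p) = subtreeF p

label-subtreeT : ∀ {T} (p : TPos T) → label (subtreeT p) ≡ tlabel p
label-subtreeF : ∀ {F} (p : FPos F) → label (subtreeF p) ≡ flabel p
label-subtreeT {node g ts} here = refl
label-subtreeT (below p) = label-subtreeF p
label-subtreeF (hd p) = label-subtreeT p
label-subtreeF (tl p) = label-subtreeF p

arc⇒pathT : ∀ {T} {x y : TPos T} → TChild x y → TPath x y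
arc⇒pathF : ∀ {F} {x y : FPos F} → FChild x y → FPath x y
arc⇒pathT (root r)  = root
arc⇒pathT (below c) = below (arc⇒pathF c)
arc⇒pathF (hd c) = hd (arc⇒pathT c)
arc⇒pathF (tl c) = tl (arc⇒pathF c)

-- F ⪯ₑ S presented tree by tree, P constraining where the roots of F go.
module Embedding {S : Forest} where

  EmbT : (FPos S → Set) → Tree → Set
  EmbF : (FPos S → Set) → Forest → Set
  EmbT P (node g ts) = Σ (FPos S) λ p → P p × flabel p ≡ g × EmbF (FPath p) ts
  EmbF P []      = ⊤
  EmbF P (T ∷ F) = EmbT P T × EmbF P F

  ιT : ∀ {P} T → EmbT P T → TPos T → FPos S
  ιF : ∀ {P} F → EmbF P F → FPos F → FPos S
  ιT (node g ts) (p , _ , _ , e) here      = p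
  ιT (node g ts) (p , _ , _ , e) (below q) = ιF ts e q
  ιF (T ∷ F) (eT , eF) (hd q) = ιT T eT q
  ιF (T ∷ F) (eT , eF) (tl q) = ιF F eF q

  ιT-label : ∀ {P} T (e : EmbT P T) (x : TPos T) → flabel (ιT T e x) ≡ tlabel x
  ιF-label : ∀ {P} F (e : EmbF P F) (x : FPos F) → flabel (ιF F e x) ≡ flabel x
  ιT-label (node g ts) (p , _ , l , e) here      = l
  ιT-label (node g ts) (p , _ , l , e) (below q) = ιF-label ts e q
  ιF-label (T ∷ F) (eT , eF) (hd q) = ιT-label T eT q
  ιF-label (T ∷ F) (eT , eF) (tl q) = ιF-label F eF q

  ιF-root : ∀ {P} F (e : EmbF P F) {r : FPos F} → FRoot r → P (ιF F e r)
  ιF-root (node g ts ∷ F) ((p , pp , _ , _) , eF) hd = pp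
  ιF-root (T ∷ F) (eT , eF) (tl r) = ιF-root F eF r

  ιT-arc : ∀ {P} T (e : EmbT P T) {x y : TPos T} → TChild x y → FPath (ιT T e x) (ιT T e y)
  ιF-arc : ∀ {P} F (e : EmbF P F) {x y : FPos F} → FChild x y → FPath (ιF F e x) (ιF F e y)
  ιT-arc (node g ts) (p , _ , _ , e) (root r)  = ιF-root ts e r
  ιT-arc (node g ts) (p , _ , _ , e) (below c) = ιF-arc ts e c
  ιF-arc (T ∷ F) (eT , eF) (hd c) = ιT-arc T eT c
  ιF-arc (T ∷ F) (eT , eF) (tl c) = ιF-arc F eF c

  EmbF⇒⪯ₑ : ∀ {P F} → EmbF P F → F ⪯ₑ S
  EmbF⇒⪯ₑ {F = F} e = ιF F e , ιF-label F e , λ x y → ιF-arc F e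

  embedT : ∀ {P} g ts (ι : TPos (node g ts) → FPos S) →
    (∀ x → flabel (ι x) ≡ tlabel x) → (∀ x y → TChild x y → FPath (ι x) (ι y)) →
    P (ι here) → EmbT P (node g ts)
  embedF : ∀ {P} F (ι : FPos F → FPos S) →
    (∀ x → flabel (ι x) ≡ flabel x) → (∀ x y → FChild x y → FPath (ι x) (ι y)) →
    (∀ r → FRoot r → P (ι r)) → EmbF P F
  embedT g ts ι lab arc root-in-P =
    ι here , root-in-P , lab here ,
    embedF ts (ι ∘ below) (lab ∘ below) (λ x y → arc _ _ ∘ below) (λ r → arc _ _ ∘ root)
  embedF []              ι lab arc roots-in-P = tt
  embedF (node g ws ∷ F) ι lab arc roots-in-P =
    embedT g ws (ι ∘ hd) (lab ∘ hd) (λ x y → arc _ _ ∘ hd) (roots-in-P _ hd) ,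
    embedF F (ι ∘ tl) (lab ∘ tl) (λ x y → arc _ _ ∘ tl) (λ r → roots-in-P _ ∘ tl)

  ⪯ₑ⇒EmbF : ∀ {F} → F ⪯ₑ S → EmbF (λ _ → ⊤) F
  ⪯ₑ⇒EmbF {F} (ι , lab , arc) = embedF F ι lab arc (λ _ _ → tt)

  EmbF-self : EmbF (λ _ → ⊤) S
  EmbF-self = ⪯ₑ⇒EmbF (id , (λ _ → refl) , λ _ _ → arc⇒pathF)

  EmbF-++⁺ : ∀ {P} F {G} → EmbF P F → EmbF P G → EmbF P (F ++ₗ G)
  EmbF-++⁺ []      eF        eG = eG
  EmbF-++⁺ (T ∷ F) (eT , eF) eG = eT , EmbF-++⁺ F eF eG

  EmbF-++⁻ : ∀ {P} F {G} → EmbF P (F ++ₗ G) → EmbF P F × EmbF P G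
  EmbF-++⁻ []      e        = tt , e
  EmbF-++⁻ (T ∷ F) (eT , e) = (eT , proj₁ (EmbF-++⁻ F e)) , proj₂ (EmbF-++⁻ F e)
open Embedding public

module Connectives {σ : Signature} where

  trueF : ∀ {n} → Formula σ (suc n)
  trueF = eq (var zero) (var zero)

  -- Nonempty conjunctions and disjunctions exist at every arity n, whereas the
  -- empty conjunction trueF needs a variable.
  ⋀⁺ : ∀ {n} k → (Fin (suc k) → Formula σ n) → Formula σ n
  ⋀⁺ zero    g = g zero
  ⋀⁺ (suc k) g = g zero ∧ ⋀⁺ k (g ∘ suc)

  ⋁⁺ : ∀ {n} k → (Fin (suc k) → Formula σ n) → Formula σ n
  ⋁⁺ zero    g = g zero
  ⋁⁺ (suc k) g = g zero ∨ ⋁⁺ k (g ∘ suc)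

  ⋀ : ∀ {n} N → (Fin N → Formula σ (suc n)) → Formula σ (suc n)
  ⋀ zero    g = trueF
  ⋀ (suc N) g = ⋀⁺ N g

  ⋀Tuples : ∀ {n} N k → (Vec (Fin N) k → Formula σ (suc n)) → Formula σ (suc n)
  ⋀Tuples N zero    g = g []
  ⋀Tuples N (suc k) g = ⋀ N λ i → ⋀Tuples N k (g ∘ (i ∷_))

  module _ (C : Structure σ) where

    ⋀⁺-intro : ∀ {n} k g {ρ : Vec (Car C) n} → (∀ i → Sat C ρ (g i)) → Sat C ρ (⋀⁺ k g)
    ⋀⁺-intro zero    g h = h zero
    ⋀⁺-intro (suc k) g h = h zero , ⋀⁺-intro k (g ∘ suc) (h ∘ suc)

    ⋀⁺-elim : ∀ {n} k g {ρ : Vec (Car C) n} → Sat C ρ (⋀⁺ k g) → ∀ i → Sat C ρ (g i)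
    ⋀⁺-elim zero    g h       zero    = h
    ⋀⁺-elim (suc k) g (h , _) zero    = h
    ⋀⁺-elim (suc k) g (_ , h) (suc i) = ⋀⁺-elim k (g ∘ suc) h i

    ⋁⁺-intro : ∀ {n} k g {ρ : Vec (Car C) n} i → Sat C ρ (g i) → Sat C ρ (⋁⁺ k g)
    ⋁⁺-intro zero    g zero    h = h
    ⋁⁺-intro (suc k) g zero    h = inj₁ h
    ⋁⁺-intro (suc k) g (suc i) h = inj₂ (⋁⁺-intro k (g ∘ suc) i h)

    ⋁⁺-elim : ∀ {n} k g {ρ : Vec (Car C) n} → Sat C ρ (⋁⁺ k g) → Σ (Fin (suc k)) λ i → Sat C ρ (g i)
    ⋁⁺-elim zero    g h        = zero , h
    ⋁⁺-elim (suc k) g (inj₁ h) = zero , h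
    ⋁⁺-elim (suc k) g (inj₂ h) = let (i , h′) = ⋁⁺-elim k (g ∘ suc) h in suc i , h′

    ⋀-intro : ∀ {n} N g {ρ : Vec (Car C) (suc n)} → (∀ i → Sat C ρ (g i)) → Sat C ρ (⋀ N g)
    ⋀-intro zero    g h = refl
    ⋀-intro (suc N) g h = ⋀⁺-intro N g h

    ⋀-elim : ∀ {n} N g {ρ : Vec (Car C) (suc n)} → Sat C ρ (⋀ N g) → ∀ i → Sat C ρ (g i)
    ⋀-elim (suc N) g h = ⋀⁺-elim N g h

    ⋀Tuples-intro : ∀ {n} N k g {ρ : Vec (Car C) (suc n)} → (∀ v → Sat C ρ (g v)) → Sat C ρ (⋀Tuples N k g)
    ⋀Tuples-intro N zero    g h = h []
    ⋀Tuples-intro N (suc k) g h = ⋀-intro N _ λ i → ⋀Tuples-intro N k (g ∘ (i ∷_)) (h ∘ (i ∷_))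

    ⋀Tuples-elim : ∀ {n} N k g {ρ : Vec (Car C) (suc n)} → Sat C ρ (⋀Tuples N k g) → ∀ v → Sat C ρ (g v)
    ⋀Tuples-elim N zero    g h []      = h
    ⋀Tuples-elim N (suc k) g h (i ∷ v) = ⋀Tuples-elim N k (g ∘ (i ∷_)) (⋀-elim N _ h i) v

  module _ {S : Forest} {P : FPos S → Set} where

    ⋀⁺-emb : ∀ {n} k (g : Fin (suc k) → Formula σ n) → (∀ i → EmbF P (qs (g i))) → EmbF P (qs (⋀⁺ k g))
    ⋀⁺-emb zero    g h = h zero
    ⋀⁺-emb (suc k) g h = EmbF-++⁺ (qs (g zero)) (h zero) (⋀⁺-emb k (g ∘ suc) (h ∘ suc))

    ⋁⁺-emb : ∀ {n} k (g : Fin (suc k) → Formula σ n) → (∀ i → EmbF P (qs (g i))) → EmbF P (qs (⋁⁺ k g))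
    ⋁⁺-emb zero    g h = h zero
    ⋁⁺-emb (suc k) g h = EmbF-++⁺ (qs (g zero)) (h zero) (⋁⁺-emb k (g ∘ suc) (h ∘ suc))

    ⋀-emb : ∀ {n} N (g : Fin N → Formula σ (suc n)) → (∀ i → EmbF P (qs (g i))) → EmbF P (qs (⋀ N g))
    ⋀-emb zero    g h = tt
    ⋀-emb (suc N) g h = ⋀⁺-emb N g h

    ⋀Tuples-emb : ∀ {n} N k (g : Vec (Fin N) k → Formula σ (suc n)) → (∀ v → EmbF P (qs (g v))) →
      EmbF P (qs (⋀Tuples N k g))
    ⋀Tuples-emb N zero    g h = h []
    ⋀Tuples-emb N (suc k) g h = ⋀-emb N _ λ i → ⋀Tuples-emb N k (g ∘ (i ∷_)) (h ∘ (i ∷_))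
open Connectives public

wk : ∀ {σ n} → Term σ n → Term σ (suc n)
wk (var i) = var (suc i)
wk (con j) = con j

evalT-wk : ∀ {σ n} (C : Structure σ) (ρ : Vec (Car C) n) x u → evalT C (x ∷ ρ) (wk u) ≡ evalT C ρ u
evalT-wk C ρ x (var i) = refl
evalT-wk C ρ x (con j) = refl

-- The relation and equality clauses of PartialIso; the constant clause is
-- recovered by listing the constants in front of the tuples.
Agree : ∀ {σ N} (A B : Structure σ) → Vec (Car A) N → Vec (Car B) N → Set
Agree {σ} {N} A B E F =
  ((R : Fin (nR σ)) (is : Vec (Fin N) (ar σ R)) →
     (rel A R (map (lookup E) is) ≡ true) ⇔ (rel B R (map (lookup F) is) ≡ true)) ×
  ((k l : Fin N) → (lookup E k ≡ lookup E l) ⇔ (lookup F k ≡ lookup F l))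

module LiteralTransfer {σ} {A B : Structure σ} {N} {E : Vec (Car A) N} {F : Vec (Car B) N}
  (agree : Agree A B E F) {n} {ρA : Vec (Car A) n} {ρB : Vec (Car B) n} (ix : Term σ n → Fin N)
  (readA : ∀ u → evalT A ρA u ≡ lookup E (ix u)) (readB : ∀ u → evalT B ρB u ≡ lookup F (ix u)) where

  private
    mapA : ∀ {k} (ts : Vec (Term σ n) k) → map (evalT A ρA) ts ≡ map (lookup E) (map ix ts)
    mapA ts = trans (map-cong readA ts) (map-∘ (lookup E) ix ts)

    mapB : ∀ {k} (ts : Vec (Term σ n) k) → map (evalT B ρB) ts ≡ map (lookup F) (map ix ts)
    mapB ts = trans (map-cong readB ts) (map-∘ (lookup F) ix ts)

    relA⇔relB : ∀ R ts → (rel A R (map (evalT A ρA) ts) ≡ true) ⇔ (rel B R (map (evalT B ρB) ts) ≡ true)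
    relA⇔relB R ts rewrite mapA ts | mapB ts = proj₁ agree R (map ix ts)

    eqA⇔eqB : ∀ u v → (evalT A ρA u ≡ evalT A ρA v) ⇔ (evalT B ρB u ≡ evalT B ρB v)
    eqA⇔eqB u v rewrite readA u | readA v | readB u | readB v = proj₂ agree (ix u) (ix v)

  atom-transfer : ∀ R ts → Sat A ρA (atom R ts) → Sat B ρB (atom R ts)
  atom-transfer R ts = to (relA⇔relB R ts)

  natom-transfer : ∀ R ts → Sat A ρA (natom R ts) → Sat B ρB (natom R ts)
  natom-transfer R ts h = h ∘ from (relA⇔relB R ts)

  eq-transfer : ∀ u v → Sat A ρA (eq u v) → Sat B ρB (eq u v)
  eq-transfer u v = to (eqA⇔eqB u v)

  neq-transfer : ∀ u v → Sat A ρA (neq u v) → Sat B ρB (neq u v)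
  neq-transfer u v h = h ∘ from (eqA⇔eqB u v)

wk∷ʳvar : ∀ {σ n m} → Vec (Term σ n) m → Vec (Term σ (suc n)) (suc m)
wk∷ʳvar τ = map wk τ ∷ʳ var zero

Names : ∀ {σ n N} (C : Structure σ) → Vec (Car C) n → Vec (Term σ n) N → Vec (Car C) N → Set
Names C ρ ν E = map (evalT C ρ) ν ≡ E

module _ {σ n} {C : Structure σ} {ρ : Vec (Car C) n} where

  Names-lookup : ∀ {N ν} {E : Vec (Car C) N} → Names C ρ ν E → ∀ k → evalT C ρ (lookup ν k) ≡ lookup E k
  Names-lookup {ν = ν} names k = trans (sym (lookup-map k (evalT C ρ) ν)) (cong (λ w → lookup w k) names)

  Names-map : ∀ {N ν} {E : Vec (Car C) N} → Names C ρ ν E →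
    ∀ {k} (is : Vec (Fin N) k) → map (evalT C ρ) (map (lookup ν) is) ≡ map (lookup E) is
  Names-map {ν = ν} names is = trans (sym (map-∘ (evalT C ρ) (lookup ν) is)) (map-cong (Names-lookup names) is)

  Names-++ : ∀ {M N κ τ} {v : Vec (Car C) M} {c : Vec (Car C) N} →
    Names C ρ κ v → Names C ρ τ c → Names C ρ (κ ++ τ) (v ++ c)
  Names-++ {κ = κ} {τ} nκ nτ = trans (map-++ (evalT C ρ) κ τ) (cong₂ _++_ nκ nτ)

  Names-wk : ∀ {N ν} {E : Vec (Car C) N} x → Names C ρ ν E → Names C (x ∷ ρ) (map wk ν) E
  Names-wk {ν = ν} x names =
    trans (sym (map-∘ (evalT C (x ∷ ρ)) wk ν)) (trans (map-cong (evalT-wk C ρ x) ν) names)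

  Names-∷ʳ : ∀ {N τ} {c : Vec (Car C) N} x → Names C ρ τ c → Names C (x ∷ ρ) (wk∷ʳvar τ) (c ∷ʳ x)
  Names-∷ʳ {τ = τ} x names =
    trans (map-∷ʳ (evalT C (x ∷ ρ)) (var zero) (map wk τ)) (cong (_∷ʳ x) (Names-wk x names))

module Diagram {σ} (A : Structure σ) where

  signedAtom : ∀ {n} → Bool → (R : Fin (nR σ)) → Vec (Term σ n) (ar σ R) → Formula σ n
  signedAtom true  = atom
  signedAtom false = natom

  signedEq : ∀ {n} → Bool → Term σ n → Term σ n → Formula σ n
  signedEq true  = eq
  signedEq false = neq

  relLiteral : ∀ {n N} → Vec (Car A) N → Vec (Term σ n) N →
    (R : Fin (nR σ)) → Vec (Fin N) (ar σ R) → Formula σ n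
  relLiteral E ν R is = signedAtom (rel A R (map (lookup E) is)) R (map (lookup ν) is)

  eqLiteral : ∀ {n N} → Vec (Car A) N → Vec (Term σ n) N → Fin N → Fin N → Formula σ n
  eqLiteral E ν k l = signedEq ⌊ lookup E k ≟ lookup E l ⌋ (lookup ν k) (lookup ν l)

  diagram : ∀ {n N} → Vec (Car A) N → Vec (Term σ (suc n)) N → Formula σ (suc n)
  diagram {N = N} E ν =
    ⋀ (nR σ) (λ R → ⋀Tuples N (ar σ R) (relLiteral E ν R)) ∧ ⋀ N (λ k → ⋀ N (eqLiteral E ν k))

  module _ {n N} {E : Vec (Car A) N} {ν : Vec (Term σ n) N} where

    relLiteral-sat : ∀ {ρ} → Names A ρ ν E → ∀ R is → Sat A ρ (relLiteral E ν R is)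
    relLiteral-sat names R is with rel A R (map (lookup E) is) in e
    ... | true  = subst (λ w → rel A R w ≡ true) (sym (Names-map names is)) e
    ... | false = not-¬ e ∘ subst (λ w → rel A R w ≡ true) (Names-map names is)

    eqLiteral-sat : ∀ {ρ} → Names A ρ ν E → ∀ k l → Sat A ρ (eqLiteral E ν k l)
    eqLiteral-sat names k l with lookup E k ≟ lookup E l
    ... | yes Ek≡El = trans (Names-lookup names k) (trans Ek≡El (sym (Names-lookup names l)))
    ... | no  Ek≢El = λ h → Ek≢El (trans (sym (Names-lookup names k)) (trans h (Names-lookup names l)))

    module _ {B : Structure σ} {F : Vec (Car B) N} {ρ} (names : Names B ρ ν F) where

      relLiteral-agree : ∀ R is → Sat B ρ (relLiteral E ν R is) →
        (rel A R (map (lookup E) is) ≡ true) ⇔ (rel B R (map (lookup F) is) ≡ true)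
      relLiteral-agree R is h with rel A R (map (lookup E) is)
      ... | true  = mk⇔ (λ _ → subst (λ w → rel B R w ≡ true) (Names-map names is) h) (λ _ → refl)
      ... | false = mk⇔ (λ ()) (λ hB → contradiction (subst (λ w → rel B R w ≡ true) (sym (Names-map names is)) hB) h)

      eqLiteral-agree : ∀ k l → Sat B ρ (eqLiteral E ν k l) → (lookup E k ≡ lookup E l) ⇔ (lookup F k ≡ lookup F l)
      eqLiteral-agree k l h with lookup E k ≟ lookup E l
      ... | yes Ek≡El = mk⇔ (λ _ → trans (sym (Names-lookup names k)) (trans h (Names-lookup names l))) (λ _ → Ek≡El)
      ... | no  Ek≢El = mk⇔ (λ e → contradiction e Ek≢El)
                            (λ e → contradiction (trans (Names-lookup names k) (trans e (sym (Names-lookup names l)))) h)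

      literals-agree : (∀ R is → Sat B ρ (relLiteral E ν R is)) → (∀ k l → Sat B ρ (eqLiteral E ν k l)) →
        Agree A B E F
      literals-agree hR hE = (λ R is → relLiteral-agree R is (hR R is)) , (λ k l → eqLiteral-agree k l (hE k l))

    module _ {S : Forest} {P : FPos S → Set} where

      relLiteral-emb : ∀ R is → EmbF P (qs (relLiteral E ν R is))
      relLiteral-emb R is with rel A R (map (lookup E) is)
      ... | true  = tt
      ... | false = tt

      eqLiteral-emb : ∀ k l → EmbF P (qs (eqLiteral E ν k l))
      eqLiteral-emb k l with ⌊ lookup E k ≟ lookup E l ⌋
      ... | true  = tt
      ... | false = tt

  module _ {n N} {E : Vec (Car A) N} {ν : Vec (Term σ (suc n)) N} where

    diagram-sat : ∀ {ρ} → Names A ρ ν E → Sat A ρ (diagram E ν)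
    diagram-sat names =
      ⋀-intro A (nR σ) _ (λ R → ⋀Tuples-intro A N (ar σ R) _ (relLiteral-sat names R)) ,
      ⋀-intro A N _ (λ k → ⋀-intro A N _ (eqLiteral-sat names k))

    diagram-agree : ∀ {B : Structure σ} {F : Vec (Car B) N} {ρ} →
      Names B ρ ν F → Sat B ρ (diagram E ν) → Agree A B E F
    diagram-agree {B} names (hR , hE) = literals-agree {E = E} {ν} names
      (λ R → ⋀Tuples-elim B N (ar σ R) (relLiteral E ν R) (⋀-elim B (nR σ) _ hR R))
      (λ k → ⋀-elim B N (eqLiteral E ν k) (⋀-elim B N _ hE k))

    diagram-emb : ∀ {S} {P : FPos S → Set} → EmbF P (qs (diagram E ν))
    diagram-emb = EmbF-++⁺ (qs (⋀ (nR σ) (λ R → ⋀Tuples N (ar σ R) (relLiteral E ν R))))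
      (⋀-emb (nR σ) _ λ R → ⋀Tuples-emb N (ar σ R) _ (relLiteral-emb {E = E} {ν} R))
      (⋀-emb N _ λ k → ⋀-emb N _ (eqLiteral-emb {E = E} {ν} k))

lookup-consts : ∀ {σ m} (C : Structure σ) (c : Vec (Car C) m) j → lookup (consts C ++ c) (j ↑ˡ m) ≡ const C j
lookup-consts C c j = trans (lookup-++ˡ (consts C) c j) (lookup∘tabulate (const C) j)

consts-expand : ∀ {σ t} (C : Structure σ) (e : Vec (Car C) t) → consts (expand C e) ≡ consts C ++ e
consts-expand C e = tabulate∘lookup (consts C ++ e)

lookup-expand-const : ∀ {σ t m} (C : Structure σ) (e : Vec (Car C) t) (c : Vec (Car C) m) j →
  lookup (consts (expand C e) ++ c) ((j ↑ˡ t) ↑ˡ m) ≡ const C j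
lookup-expand-const {t = t} C e c j = trans (lookup-consts (expand C e) c (j ↑ˡ t)) (lookup-consts C e j)

lookup-expand-new : ∀ {σ t} (C : Structure σ) (e : Vec (Car C) t) i →
  lookup (consts (expand C e) ++ []) ((nC σ ↑ʳ i) ↑ˡ 0) ≡ lookup e i
lookup-expand-new {σ} C e i = trans (lookup-consts (expand C e) [] (nC σ ↑ʳ i)) (lookup-++ʳ (consts C) e i)

expandNames : ∀ {σ t} → Vec (Term σ t) (nC σ + t)
expandNames = tabulate con ++ tabulate var

Names-expandNames : ∀ {σ t} (C : Structure σ) (e : Vec (Car C) t) → Names C e expandNames (consts (expand C e))
Names-expandNames C e = begin
  map (evalT C e) (tabulate con ++ tabulate var)
    ≡⟨ map-++ (evalT C e) (tabulate con) (tabulate var) ⟩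
  map (evalT C e) (tabulate con) ++ map (evalT C e) (tabulate var)
    ≡⟨ cong₂ _++_ (sym (tabulate-∘ (evalT C e) con)) (sym (tabulate-∘ (evalT C e) var)) ⟩
  consts C ++ tabulate (lookup e)
    ≡⟨ cong (consts C ++_) (tabulate∘lookup e) ⟩
  consts C ++ e
    ≡⟨ sym (consts-expand C e) ⟩
  consts (expand C e) ∎
  where open ≡-Reasoning

module Game {σ} (A B : Structure σ) {t} (a : Vec (Car A) t) (b : Vec (Car B) t) where

  A′ = expand A a
  B′ = expand B b
  K = nC σ + t

  posA : ∀ {m} → Vec (Car A) m → Vec (Car A) (K + m)
  posA c = consts A′ ++ c

  posB : ∀ {m} → Vec (Car B) m → Vec (Car B) (K + m)
  posB d = consts B′ ++ d

  PI : ∀ {m} → Vec (Car A) m → Vec (Car B) m → Set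
  PI c d = PartialIso A′ B′ (posA c) (posB d)

  WT : ∀ {m} → Tree → Vec (Car A) m → Vec (Car B) m → Set
  WT = WinT A′ B′

  WF : ∀ {m} → Forest → Vec (Car A) m → Vec (Car B) m → Set
  WF = WinF A′ B′

  partialIso⇒agree : ∀ {m} {c : Vec (Car A) m} {d} → PI c d → Agree A B (posA c) (posB d)
  partialIso⇒agree (rels , eqs , _) = rels , eqs

  agree⇒partialIso : ∀ {m} {c : Vec (Car A) m} {d} → Agree A B (posA c) (posB d) → PI c d
  agree⇒partialIso {m} {c} {d} (rels , eqs) = rels , eqs , λ j i →
    let cA = lookup-consts A′ c j
        cB = lookup-consts B′ d j
    in mk⇔ (λ h → trans (to (eqs i (j ↑ˡ m)) (trans h (sym cA))) cB)
           (λ h → trans (from (eqs i (j ↑ˡ m)) (trans h (sym cB))) cA)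

  Answer : ∀ {m} → Forest → Vec (Car A) m → Vec (Car B) m → Car A → Car B → Set
  Answer ts c d x y = PI (c ∷ʳ x) (d ∷ʳ y) × WF ts (c ∷ʳ x) (d ∷ʳ y)

  answer-∃ : ∀ {m} {c : Vec (Car A) m} {d} T → label T ≡ ∃ₗ → WT T c d →
    (x : Car A) → Σ (Car B) (Answer (children T) c d x)
  answer-∃ (node ∃ₗ ts) refl w = w

  answer-∀ : ∀ {m} {c : Vec (Car A) m} {d} T → label T ≡ ∀ₗ → WT T c d →
    (y : Car B) → Σ (Car A) λ x → Answer (children T) c d x y
  answer-∀ (node ∀ₗ ts) refl w = w

  -- Spoiler plays an arbitrary element (structures are nonempty); such rounds
  -- play through the nodes of S that an embedding skips.
  someRound : ∀ {m} {c : Vec (Car A) m} {d} T → WT T c d →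
    Σ (Car A) λ x → Σ (Car B) (Answer (children T) c d x)
  someRound (node ∃ₗ ts) w = let (y , r) = w zero in zero , y , r
  someRound (node ∀ₗ ts) w = let (x , r) = w zero in x , zero , r

  Extends : ∀ {m m′} → Vec (Car A) m → Vec (Car B) m → Vec (Car A) m′ → Vec (Car B) m′ → Set
  Extends {m} {m′} c d c′ d′ = Σ (Fin (K + m) → Fin (K + m′)) λ h →
    ∀ k → lookup (posA c′) (h k) ≡ lookup (posA c) k × lookup (posB d′) (h k) ≡ lookup (posB d) k

  Extends-refl : ∀ {m} {c : Vec (Car A) m} {d} → Extends c d c d
  Extends-refl = id , λ _ → refl , refl

  Extends-trans : ∀ {m₁ m₂ m₃} {c₁ : Vec (Car A) m₁} {d₁} {c₂ : Vec (Car A) m₂} {d₂}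
    {c₃ : Vec (Car A) m₃} {d₃} → Extends c₁ d₁ c₂ d₂ → Extends c₂ d₂ c₃ d₃ → Extends c₁ d₁ c₃ d₃
  Extends-trans (h₁ , p₁) (h₂ , p₂) = h₂ ∘ h₁ , λ k →
    trans (proj₁ (p₂ (h₁ k))) (proj₁ (p₁ k)) , trans (proj₂ (p₂ (h₁ k))) (proj₂ (p₁ k))

  Extends-∷ʳ : ∀ {m} {c : Vec (Car A) m} {d} x y → Extends c d (c ∷ʳ x) (d ∷ʳ y)
  Extends-∷ʳ {c = c} {d} x y =
    inject∷ʳ K , λ k → lookup-inject∷ʳ (consts A′) c x k , lookup-inject∷ʳ (consts B′) d y k

  record Reaches {m} (c : Vec (Car A) m) (d : Vec (Car B) m) (T : Tree) : Set where
    constructor reach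
    field
      {m′}       : ℕ
      c′         : Vec (Car A) m′
      d′         : Vec (Car B) m′
      extends    : Extends c d c′ d′
      partialIso : PI c′ d′
      wins       : WT T c′ d′

  Reaches-extend : ∀ {m m′} {c : Vec (Car A) m} {d} {c′ : Vec (Car A) m′} {d′} {T} →
    Extends c d c′ d′ → Reaches c′ d′ T → Reaches c d T
  Reaches-extend e (reach c″ d″ e′ p w) = reach c″ d″ (Extends-trans e e′) p w

  reach-position : ∀ {F m} {c : Vec (Car A) m} {d} → WF F c d → PI c d → (q : FPos F) → Reaches c d (subtreeF q)
  reach-position {c = c} {d} (w , _) pi (hd here) = reach c d Extends-refl pi w
  reach-position {T ∷ _} (w , _) pi (hd (below q)) =
    let (x , y , pi′ , wf) = someRound T w in Reaches-extend (Extends-∷ʳ x y) (reach-position wf pi′ q)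
  reach-position (_ , wf) pi (tl q) = reach-position wf pi q

  reach-pathT : ∀ {T} {p q : TPos T} {m} {c : Vec (Car A) m} {d} →
    WF (children (subtreeT p)) c d → PI c d → TPath p q → Reaches c d (subtreeT q)
  reach-pathF : ∀ {F} {p q : FPos F} {m} {c : Vec (Car A) m} {d} →
    WF (children (subtreeF p)) c d → PI c d → FPath p q → Reaches c d (subtreeF q)
  reach-pathT {node g ts} wf pi (root {q = r}) = reach-position wf pi r
  reach-pathT wf pi (below pq) = reach-pathF wf pi pq
  reach-pathF wf pi (hd pq) = reach-pathT wf pi pq
  reach-pathF wf pi (tl pq) = reach-pathF wf pi pq

  record Simulation {S : Forest} (P : FPos S → Set) {n} (ρA : Vec (Car A) n) (ρB : Vec (Car B) n) : Set where
    constructor simulation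
    field
      {m}       : ℕ
      c         : Vec (Car A) m
      d         : Vec (Car B) m
      index     : Fin n → Fin (K + m)
      readA     : ∀ i → lookup ρA i ≡ lookup (posA c) (index i)
      readB     : ∀ i → lookup ρB i ≡ lookup (posB d) (index i)
      agree     : Agree A B (posA c) (posB d)
      reachable : ∀ q → P q → Reaches c d (subtreeF q)

    termIndex : Term σ n → Fin (K + m)
    termIndex (var i) = index i
    termIndex (con j) = (j ↑ˡ t) ↑ˡ m

    readTermA : ∀ u → evalT A ρA u ≡ lookup (posA c) (termIndex u)
    readTermA (var i) = readA i
    readTermA (con j) = sym (lookup-expand-const A a c j)

    readTermB : ∀ u → evalT B ρB u ≡ lookup (posB d) (termIndex u)
    readTermB (var i) = readB i
    readTermB (con j) = sym (lookup-expand-const B b d j)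

    open LiteralTransfer {E = posA c} {F = posB d} agree termIndex readTermA readTermB public

  module _ {S : Forest} where

    step : ∀ {P : FPos S → Set} {n} {ρA : Vec (Car A) n} {ρB} (s : Simulation P ρA ρB) (p : FPos S)
      {m′} {c′ : Vec (Car A) m′} {d′} {x y} →
      Extends (Simulation.c s) (Simulation.d s) c′ d′ → Answer (children (subtreeF p)) c′ d′ x y →
      Simulation (FPath p) (x ∷ ρA) (y ∷ ρB)
    step s p {m′} {c′} {d′} {x} {y} (h , h-reads) (pi , wf) =
      simulation (c′ ∷ʳ x) (d′ ∷ʳ y) index′ readA′ readB′
        (partialIso⇒agree pi) (λ q → reach-pathF wf pi)
      where
      open Simulation s using (index; readA; readB)

      index′ : Fin (suc _) → Fin (K + suc m′)
      index′ zero    = last∷ʳ K m′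
      index′ (suc i) = inject∷ʳ K (h (index i))

      readA′ : ∀ i → lookup (x ∷ _) i ≡ lookup (posA (c′ ∷ʳ x)) (index′ i)
      readA′ zero    = sym (lookup-last∷ʳ (consts A′) c′ x)
      readA′ (suc i) = trans (readA i)
        (trans (sym (proj₁ (h-reads (index i)))) (sym (lookup-inject∷ʳ (consts A′) c′ x _)))

      readB′ : ∀ i → lookup (y ∷ _) i ≡ lookup (posB (d′ ∷ʳ y)) (index′ i)
      readB′ zero    = sym (lookup-last∷ʳ (consts B′) d′ y)
      readB′ (suc i) = trans (readB i)
        (trans (sym (proj₂ (h-reads (index i)))) (sym (lookup-inject∷ʳ (consts B′) d′ y _)))

    transfer : ∀ {n} (φ : Formula σ n) {P : FPos S → Set} {ρA ρB} →
      EmbF P (qs φ) → Simulation P ρA ρB → Sat A ρA φ → Sat B ρB φ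
    transfer (atom R ts) _ s = Simulation.atom-transfer s R ts
    transfer (natom R ts) _ s = Simulation.natom-transfer s R ts
    transfer (eq u v) _ s = Simulation.eq-transfer s u v
    transfer (neq u v) _ s = Simulation.neq-transfer s u v
    transfer (φ ∧ ψ) e s (hφ , hψ) =
      let (eφ , eψ) = EmbF-++⁻ (qs φ) e in transfer φ eφ s hφ , transfer ψ eψ s hψ
    transfer (φ ∨ ψ) e s (inj₁ h) = inj₁ (transfer φ (proj₁ (EmbF-++⁻ (qs φ) e)) s h)
    transfer (φ ∨ ψ) e s (inj₂ h) = inj₂ (transfer ψ (proj₂ (EmbF-++⁻ (qs φ) e)) s h)
    transfer (ex θ) ((p , pp , lab , eθ) , _) s (x , h) =
      let reach _ _ ext _ w = Simulation.reachable s p pp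
          (y , answer) = answer-∃ (subtreeF p) (trans (label-subtreeF p) lab) w x
      in y , transfer θ eθ (step s p ext answer) h
    transfer (all θ) ((p , pp , lab , eθ) , _) s h y =
      let reach _ _ ext _ w = Simulation.reachable s p pp
          (x , answer) = answer-∀ (subtreeF p) (trans (label-subtreeF p) lab) w y
      in transfer θ eθ (step s p ext answer) (h x)

    Duplicates⇒tp⊆ : Duplicates A′ B′ S → tp S A a ⊆ tp S B b
    Duplicates⇒tp⊆ (pi , wf) {φ} (emb , h) = emb , transfer φ (⪯ₑ⇒EmbF emb) initial h
      where
      initial : Simulation (λ _ → ⊤) a b
      initial = simulation [] [] (λ i → (nC σ ↑ʳ i) ↑ˡ 0)
        (λ i → sym (lookup-expand-new A a i)) (λ i → sym (lookup-expand-new B b i))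
        (partialIso⇒agree pi) (λ q _ → reach-position wf pi q)

  open Diagram A

  -- κ names the constants of A′ and τ the elements c picked so far.
  hintikkaT : ∀ {n m} → Tree → Vec (Car A) m → Vec (Term σ n) K → Vec (Term σ n) m → Formula σ n
  hintikkaF : ∀ {n m} → Forest → Vec (Car A) m → Vec (Term σ (suc n)) K → Vec (Term σ (suc n)) m →
    Formula σ (suc n)
  afterRound : ∀ {n m} → Forest → Vec (Car A) m → Vec (Term σ n) K → Vec (Term σ n) m → Car A →
    Formula σ (suc n)
  hintikkaT (node ∃ₗ ts) c κ τ = ⋀⁺ (size A) (ex ∘ afterRound ts c κ τ)
  hintikkaT (node ∀ₗ ts) c κ τ = all (⋁⁺ (size A) (afterRound ts c κ τ))
  hintikkaF []      c κ τ = trueF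
  hintikkaF (T ∷ F) c κ τ = hintikkaT T c κ τ ∧ hintikkaF F c κ τ
  afterRound ts c κ τ x =
    diagram (posA (c ∷ʳ x)) (map wk κ ++ wk∷ʳvar τ) ∧ hintikkaF ts (c ∷ʳ x) (map wk κ) (wk∷ʳvar τ)

  hintikkaT-sat : ∀ T {m} {c : Vec (Car A) m} {n} {ρ : Vec (Car A) n} {κ τ} →
    Names A ρ κ (consts A′) → Names A ρ τ c → Sat A ρ (hintikkaT T c κ τ)
  hintikkaF-sat : ∀ F {m} {c : Vec (Car A) m} {n} {ρ : Vec (Car A) (suc n)} {κ τ} →
    Names A ρ κ (consts A′) → Names A ρ τ c → Sat A ρ (hintikkaF F c κ τ)
  afterRound-sat : ∀ ts {m} {c : Vec (Car A) m} {n} {ρ : Vec (Car A) n} {κ τ} x →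
    Names A ρ κ (consts A′) → Names A ρ τ c → Sat A (x ∷ ρ) (afterRound ts c κ τ x)
  hintikkaT-sat (node ∃ₗ ts) nκ nτ = ⋀⁺-intro A (size A) _ λ x → x , afterRound-sat ts x nκ nτ
  hintikkaT-sat (node ∀ₗ ts) nκ nτ x = ⋁⁺-intro A (size A) _ x (afterRound-sat ts x nκ nτ)
  hintikkaF-sat []      nκ nτ = refl
  hintikkaF-sat (T ∷ F) nκ nτ = hintikkaT-sat T nκ nτ , hintikkaF-sat F nκ nτ
  afterRound-sat ts x nκ nτ =
    let nκ′ = Names-wk x nκ
        nτ′ = Names-∷ʳ x nτ
    in diagram-sat (Names-++ nκ′ nτ′) , hintikkaF-sat ts nκ′ nτ′

  hintikkaT-wins : ∀ T {m} {c : Vec (Car A) m} {n} {ρ : Vec (Car B) n} {d} {κ τ} →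
    Names B ρ κ (consts B′) → Names B ρ τ d → Sat B ρ (hintikkaT T c κ τ) → WT T c d
  hintikkaF-wins : ∀ F {m} {c : Vec (Car A) m} {n} {ρ : Vec (Car B) (suc n)} {d} {κ τ} →
    Names B ρ κ (consts B′) → Names B ρ τ d → Sat B ρ (hintikkaF F c κ τ) → WF F c d
  afterRound-answers : ∀ ts {m} {c : Vec (Car A) m} {n} {ρ : Vec (Car B) n} {d} {κ τ} x y →
    Names B ρ κ (consts B′) → Names B ρ τ d → Sat B (y ∷ ρ) (afterRound ts c κ τ x) → Answer ts c d x y
  hintikkaT-wins (node ∃ₗ ts) nκ nτ h x =
    let (y , hy) = ⋀⁺-elim B (size A) _ h x in y , afterRound-answers ts x y nκ nτ hy
  hintikkaT-wins (node ∀ₗ ts) nκ nτ h y =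
    let (x , hx) = ⋁⁺-elim B (size A) _ (h y) in x , afterRound-answers ts x y nκ nτ hx
  hintikkaF-wins []      nκ nτ h        = tt
  hintikkaF-wins (T ∷ F) nκ nτ (hT , hF) = hintikkaT-wins T nκ nτ hT , hintikkaF-wins F nκ nτ hF
  afterRound-answers ts {c = c} x y nκ nτ (hΔ , hχ) =
    let nκ′ = Names-wk y nκ
        nτ′ = Names-∷ʳ y nτ
    in agree⇒partialIso (diagram-agree {E = posA (c ∷ʳ x)} (Names-++ nκ′ nτ′) hΔ) ,
       hintikkaF-wins ts nκ′ nτ′ hχ

  module _ {S : Forest} where

    hintikkaT-emb : ∀ T {m} {c : Vec (Car A) m} {n} {κ : Vec (Term σ n) K} {τ} {P : FPos S → Set} →
      EmbT P T → EmbF P (qs (hintikkaT T c κ τ))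
    hintikkaF-emb : ∀ F {m} {c : Vec (Car A) m} {n} {κ : Vec (Term σ (suc n)) K} {τ} {P : FPos S → Set} →
      EmbF P F → EmbF P (qs (hintikkaF F c κ τ))
    afterRound-emb : ∀ ts {m} {c : Vec (Car A) m} {n} {κ : Vec (Term σ n) K} {τ} {P : FPos S → Set} →
      EmbF P ts → ∀ x → EmbF P (qs (afterRound ts c κ τ x))
    hintikkaT-emb (node ∃ₗ ts) (p , pp , lab , e) =
      ⋀⁺-emb (size A) _ λ x → (p , pp , lab , afterRound-emb ts e x) , tt
    hintikkaT-emb (node ∀ₗ ts) (p , pp , lab , e) =
      (p , pp , lab , ⋁⁺-emb (size A) _ (afterRound-emb ts e)) , tt
    hintikkaF-emb []      e         = tt
    hintikkaF-emb (T ∷ F) {c = c} {κ = κ} {τ} (eT , eF) =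
      EmbF-++⁺ (qs (hintikkaT T c κ τ)) (hintikkaT-emb T eT) (hintikkaF-emb F eF)
    afterRound-emb ts {c = c} {κ = κ} {τ} e x =
      EmbF-++⁺ (qs (diagram (posA (c ∷ʳ x)) (map wk κ ++ wk∷ʳvar τ)))
        (diagram-emb {E = posA (c ∷ʳ x)} {map wk κ ++ wk∷ʳvar τ}) (hintikkaF-emb ts e)

  tp⊆⇒Duplicates : ∀ {S} → tp S A a ⊆ tp S B b → Duplicates A′ B′ S
  tp⊆⇒Duplicates {S} incl = agree⇒partialIso initial , hintikka-roots S EmbF-self
    where
    preserved : ∀ φ → EmbF {S} (λ _ → ⊤) (qs φ) → Sat A a φ → Sat B b φ
    preserved φ e h = proj₂ (incl (EmbF⇒⪯ₑ e , h))

    initial : Agree A B (posA []) (posB [])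
    initial = literals-agree {E = E₀} {ν₀} (Names-++ (Names-expandNames B b) refl)
      (λ R is → preserved (relLiteral E₀ ν₀ R is) (relLiteral-emb {E = E₀} {ν₀} R is)
                  (relLiteral-sat namesA R is))
      (λ k l → preserved (eqLiteral E₀ ν₀ k l) (eqLiteral-emb {E = E₀} {ν₀} k l)
                 (eqLiteral-sat namesA k l))
      where
      E₀ : Vec (Car A) (K + 0)
      E₀ = posA []

      ν₀ : Vec (Term σ t) (K + 0)
      ν₀ = expandNames ++ []

      namesA : Names A a ν₀ E₀
      namesA = Names-++ (Names-expandNames A a) refl

    hintikka-roots : ∀ F → EmbF {S} (λ _ → ⊤) F → WF F [] []
    hintikka-roots []      _         = tt
    hintikka-roots (T ∷ F) (eT , eF) =
      hintikkaT-wins T (Names-expandNames B b) refl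
        (preserved (hintikkaT T [] expandNames []) (hintikkaT-emb T eT) (hintikkaT-sat T (Names-expandNames A a) refl)) ,
      hintikka-roots F eF

theorem3p8 : {σ : Signature} (A B : Structure σ) (t : ℕ)
    (a : Vec (Car A) t) (b : Vec (Car B) t) (S : Forest) →
    ((i : Fin t) (j : Fin (nC σ)) → const A j ≢ lookup a i) →
    ((i : Fin t) (j : Fin (nC σ)) → const B j ≢ lookup b i) →
    Duplicates (expand A a) (expand B b) S ⇔ (tp S A a ⊆ tp S B b)
theorem3p8 A B t a b S _ _ = mk⇔ Duplicates⇒tp⊆ tp⊆⇒Duplicates
  where open Game A B a b
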